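{- Let $G$ and $H$ be graphs, $V(G)=\{v_1,\dots,v_n\}$, and suppose there is a vertex $u\in V(G)$ with eccentricity $\varepsilon(u)\le 2$. Let $L=N_G(u)$ and $U=V(G)\setminus N_G(u)$. Then (i) $L$ and $U$ form a bipartition of $\widehat{G}$ (both are independent sets of $\widehat{G}$); (ii) the set $S=\big(\bigcup_{v_i\in U} V(H_i)\big)\cup L$ is a distance-equalizer set of $G\odot H$; (iii) $\beta^*(G)=0$; (iv) $\xi(G\odot K_1)=\mathrm{n}(G)$.
   Context: All graphs are finite, simple and undirected; $\mathrm{n}(G)$ is the order of $G$, $N_G(u)$ the open neighbourhood of $u$, and $\varepsilon(u)=\max_{x\in V(G)} d_G(u,x)$. For a connected graph $\Gamma$, a set $S\subseteq V(\Gamma)$ is a distance-equalizer set if for every two distinct $u,v\in V(\Gamma)\setminus S$ there is $w\in S$ with $d_\Gamma(w,u)=d_\Gamma(w,v)$; $\xi(\Gamma)$ is the minimum cardinality of such a set. The corona product $G\odot H$ is obtained from $G$ and $n$ pairwise disjoint copies $H_1,\dots,H_n$ of $H$ by joining $v_i$ to every vertex of $H_i$. The empty bisector graph $\widehat{G}$ has vertex set $V(G)$, with distinct $x,y$ adjacent iff there is no $w\in V(G)$ with $d_G(w,x)=d_G(w,y)$. A pair $(X,Y)$ of subsets of $V(G)$ with $X\cup Y=V(G)$ is a forward-equalized pair of $G$ if for every $(x,y)\in (X\setminus Y)\times(Y\setminus X)$ there exists $w\in V(G)$ with $d_G(w,x)=d_G(w,y)+1$. $\beta^*(G)=\min\{|X\cap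 Y| : X,Y \text{ vertex covers of } \widehat{G},\ (X,Y) \text{ a forward-equalized pair of } G\}$. -}

module Defs where

open import Data.Nat using (ℕ; zero; suc; _*_; _≤_)
open import Data.Fin using (Fin; zero; suc; remQuot; _≟_)
open import Data.Fin.Subset using (Subset; _∈_; _∉_; _∩_; ∣_∣)
open import Data.Bool using (Bool; true; false; _∧_; not)
open import Data.Product using (Σ; ∃; _×_; _,_)
open import Data.Sum using (_⊎_)
open import Relation.Nullary using (¬_; yes; no)
open import Relation.Nullary.Decidable using (⌊_⌋)
open import Relation.Binary.PropositionalEquality using (_≡_; _≢_; refl; sym)

record Graph (n : ℕ) : Set where
  field
    adj    : Fin n → Fin n → Bool
    adj-sym    : ∀ x y → adj x y ≡ adj y x
    adj-irrefl : ∀ x → adj x x ≡ false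
open Graph public

Edge : ∀ {n} → Graph n → Fin n → Fin n → Set
Edge G x y = adj G x y ≡ true

data Walk {n} (G : Graph n) : Fin n → Fin n → ℕ → Set where
  here : ∀ {x} → Walk G x x zero
  step : ∀ {x y z k} → Edge G x y → Walk G y z k → Walk G x z (suc k)

Dist : ∀ {n} → Graph n → Fin n → Fin n → ℕ → Set
Dist G x y k = Walk G x y k × (∀ j → Walk G x y j → k ≤ j)

EqDist : ∀ {n} → Graph n → Fin n → Fin n → Fin n → Set
EqDist G w x y = ∃ λ k → Dist G w x k × Dist G w y k

EccLe : ∀ {n} → Graph n → Fin n → ℕ → Set
EccLe G u k = ∀ x → ∃ λ m → Dist G u x m × m ≤ k

-- Adjacency in the empty bisector graph Ĝ
EBAdj : ∀ {n} → Graph n → Fin n → Fin n → Set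
EBAdj G x y = x ≢ y × ¬ (∃ λ w → EqDist G w x y)

IndepEB : ∀ {n} → Graph n → (Fin n → Set) → Set
IndepEB G P = ∀ x y → P x → P y → ¬ EBAdj G x y

VertexCoverEB : ∀ {n} → Graph n → Subset n → Set
VertexCoverEB G X = ∀ x y → EBAdj G x y → x ∈ X ⊎ y ∈ X

ForwardEqualized : ∀ {n} → Graph n → Subset n → Subset n → Set
ForwardEqualized G X Y =
  (∀ v → v ∈ X ⊎ v ∈ Y) ×
  (∀ x y → x ∈ X → x ∉ Y → y ∈ Y → y ∉ X →
     ∃ λ w → ∃ λ k → Dist G w x (suc k) × Dist G w y k)

BetaFeasible : ∀ {n} → Graph n → Subset n → Subset n → Set
BetaFeasible G X Y = VertexCoverEB G X × VertexCoverEB G Y × ForwardEqualized G X Y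

BetaStar : ∀ {n} → Graph n → ℕ → Set
BetaStar G b =
  (∃ λ X → ∃ λ Y → BetaFeasible G X Y × ∣ X ∩ Y ∣ ≡ b) ×
  (∀ X Y → BetaFeasible G X Y → b ≤ ∣ X ∩ Y ∣)

DistanceEqualizer : ∀ {n} → Graph n → Subset n → Set
DistanceEqualizer Γ S =
  ∀ u v → u ≢ v → u ∉ S → v ∉ S → ∃ λ w → w ∈ S × EqDist Γ w u v

Xi : ∀ {n} → Graph n → ℕ → Set
Xi Γ k =
  (∃ λ S → DistanceEqualizer Γ S × ∣ S ∣ ≡ k) ×
  (∀ S → DistanceEqualizer Γ S → k ≤ ∣ S ∣)

-- The vertex set of G ⊙ H is
-- Fin (n * suc k); a vertex x corresponds to the pair remQuot (suc k) x = (i , a):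
-- a = zero is the vertex v_i of G, a = suc b is vertex b of the copy H_i.

private
  ≟-sym : ∀ {n} (i j : Fin n) → ⌊ i ≟ j ⌋ ≡ ⌊ j ≟ i ⌋
  ≟-sym i j with i ≟ j | j ≟ i
  ... | yes _ | yes _ = refl
  ... | no _  | no _  = refl
  ... | yes p | no q  with q (sym p)
  ... | ()
  ≟-sym i j | no p | yes q with p (sym q)
  ... | ()

  ≟-refl : ∀ {n} (i : Fin n) → ⌊ i ≟ i ⌋ ≡ true
  ≟-refl i with i ≟ i
  ... | yes _ = refl
  ... | no q with q refl
  ... | ()

coronaAdj : ∀ {n k} → Graph n → Graph k →
            Fin n × Fin (suc k) → Fin n × Fin (suc k) → Bool
coronaAdj G H (i , zero)  (j , zero)  = adj G i j
coronaAdj G H (i , zero)  (j , suc b) = ⌊ i ≟ j ⌋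
coronaAdj G H (i , suc a) (j , zero)  = ⌊ i ≟ j ⌋
coronaAdj G H (i , suc a) (j , suc b) = ⌊ i ≟ j ⌋ ∧ adj H a b

private
  coronaAdj-sym : ∀ {n k} (G : Graph n) (H : Graph k) p q →
                  coronaAdj G H p q ≡ coronaAdj G H q p
  coronaAdj-sym G H (i , zero)  (j , zero)  = adj-sym G i j
  coronaAdj-sym G H (i , zero)  (j , suc b) = ≟-sym i j
  coronaAdj-sym G H (i , suc a) (j , zero)  = ≟-sym i j
  coronaAdj-sym G H (i , suc a) (j , suc b)
    rewrite ≟-sym i j | adj-sym H a b = refl

  coronaAdj-irrefl : ∀ {n k} (G : Graph n) (H : Graph k) p →
                     coronaAdj G H p p ≡ false
  coronaAdj-irrefl G H (i , zero)  = adj-irrefl G i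
  coronaAdj-irrefl G H (i , suc a) rewrite ≟-refl i = adj-irrefl H a

corona : ∀ {n k} → Graph n → Graph k → Graph (n * suc k)
corona {n} {k} G H = record
  { adj        = λ x y → coronaAdj G H (remQuot (suc k) x) (remQuot (suc k) y)
  ; adj-sym    = λ x y → coronaAdj-sym G H (remQuot (suc k) x) (remQuot (suc k) y)
  ; adj-irrefl = λ x → coronaAdj-irrefl G H (remQuot (suc k) x)
  }

K₁ : Graph 1
K₁ = record { adj = λ _ _ → false ; adj-sym = λ _ _ → refl ; adj-irrefl = λ _ → refl }

-- The set S = (⋃_{v_i ∈ U} V(H_i)) ∪ L of part (ii), with L = N_G(u), U = V(G) ∖ L.
coronaS : ∀ {n k} → Graph n → Fin n → Fin (n * suc k) → Bool
coronaS {n} {k} G u x with remQuot {n} (suc k) x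
... | (i , zero)  = adj G u i
... | (i , suc _) = not (adj G u i)

open import Data.Vec using (tabulate)

coronaSet : ∀ {n k} → Graph n → Fin n → Subset (n * suc k)
coronaSet {n} {k} G u = tabulate (coronaS {n} {k} G u)

{-# OPTIONS --safe #-}
-- Since ε(u) ≤ 2, G is layered as {u}, L = N(u) and U ∖ {u}, the last at distance exactly 2
-- from u.  Two vertices of L are equidistant from u; two vertices of U ∖ {u} likewise, and u
-- and a vertex at distance 2 are equidistant from the middle vertex of a shortest path.  So
-- no edge of Ĝ lies inside L or U, which gives (i), and (U, L) is a feasible pair for β*
-- with U ∩ L = ∅, which gives (iii).
-- In G ⊙ H, every vertex outside S other than v_u is at distance exactly 3 from a fixed
-- vertex h₀ of H_u ⊆ S (the lower bound comes from a 1-Lipschitz potential), while a pair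
-- containing v_u is equalized by a common neighbour v_l with l ∈ L; this gives (ii).
-- For (iv), a pendant vertex and its support are equidistant from no vertex, so every
-- distance-equalizer set of G ⊙ K₁ meets each of the n pairs {v_i, h_i}, and S meets each
-- of them exactly once.
module Submission where

open import Defs
open import Data.Nat using (ℕ; suc; _*_)
open import Data.Fin using (Fin)
open import Data.Product using (_×_)
open import Relation.Nullary using (¬_)
open import Relation.Binary.PropositionalEquality using (_≡_)

open import Data.Bool using (Bool; true; false; not)
open import Data.Bool.Properties using (T-≡; ∧-conicalˡ; ∧-conicalʳ; not-involutive)
open import Data.Fin using (zero; suc; combine; remQuot; _≟_)
open import Data.Fin.Properties using (remQuot-combine; combine-remQuot; combine-injectiveʳ)
open import Data.Fin.Subset using (Subset; _∈_; _∉_; ∁; ∣_∣)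
open import Data.Fin.Subset.Properties
  using (_∈?_; x∉∁p⇒x∈p; x∉p⇒x∈∁p; drop-there; ∣p∣≤∣x∷p∣; ∣⊥∣≡0; ∩-inverseˡ)
open import Data.Nat using (zero; _+_; _≤_; z≤n; s≤s)
open import Data.Nat.Properties
  using (≤-refl; ≤-trans; ≤-reflexive; n≤1+n; m≤n+m; n≮n; +-identityʳ; +-suc; +-monoˡ-≤;
         +-cancelˡ-≤; module ≤-Reasoning)
open import Data.Product using (∃; _,_; proj₁; uncurry)
open import Data.Sum using (_⊎_; inj₁; inj₂)
import Data.Sum as Sum
open import Data.Vec using ([]; _∷_; there; tabulate; lookup)
open import Data.Vec.Properties using (lookup∘tabulate; lookup⇒[]=; []=⇒lookup)
open import Function using (_∘_)
open import Function.Bundles using (Equivalence)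
open import Relation.Nullary using (yes; no; contradiction)
open import Relation.Nullary.Decidable using (⌊_⌋; toWitness; fromWitness)
open import Relation.Binary.PropositionalEquality
  using (_≢_; refl; sym; trans; cong; subst; subst₂; module ≡-Reasoning)

≟⇒≡ : ∀ {N} {i j : Fin N} → ⌊ i ≟ j ⌋ ≡ true → i ≡ j
≟⇒≡ e = toWitness (Equivalence.from T-≡ e)

≡⇒≟ : ∀ {N} {i j : Fin N} → i ≡ j → ⌊ i ≟ j ⌋ ≡ true
≡⇒≟ e = Equivalence.to T-≡ (fromWitness e)

∈-tabulate⁺ : ∀ {N} (f : Fin N → Bool) {x} → f x ≡ true → x ∈ tabulate f
∈-tabulate⁺ f {x} e = lookup⇒[]= x _ (trans (lookup∘tabulate f x) e)

∈-tabulate⁻ : ∀ {N} (f : Fin N → Bool) {x} → x ∈ tabulate f → f x ≡ true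
∈-tabulate⁻ f {x} x∈ = trans (sym (lookup∘tabulate f x)) ([]=⇒lookup x∈)

module _ {n} (G : Graph n) where

  edge-sym : ∀ {x y} → Edge G x y → Edge G y x
  edge-sym {x} {y} e = trans (adj-sym G y x) e

  edge⇒≢ : ∀ {x y} → Edge G x y → x ≢ y
  edge⇒≢ {x} e refl with () ← trans (sym e) (adj-irrefl G x)

  Lipschitz : (Fin n → ℕ) → Set
  Lipschitz F = ∀ {x y} → Edge G x y → F y ≤ suc (F x)

module _ {n} {G : Graph n} where

  walk₀⇒≡ : ∀ {x y} → Walk G x y 0 → x ≡ y
  walk₀⇒≡ here = refl

  walk-unsnoc : ∀ {x z k} → Walk G x z (suc k) → ∃ λ y → Walk G x y k × Edge G y z
  walk-unsnoc (step e here)       = _ , here , e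
  walk-unsnoc (step e w@(step _ _)) with y , w′ , e′ ← walk-unsnoc w = y , step e w′ , e′

  dist-refl : ∀ {x} → Dist G x x 0
  dist-refl = here , λ _ _ → z≤n

  dist-edge : ∀ {x y} → Edge G x y → Dist G x y 1
  dist-edge e = step e here , λ where
    zero    w → contradiction (walk₀⇒≡ w) (edge⇒≢ G e)
    (suc _) _ → s≤s z≤n

  eqDist-sym : ∀ {w x y} → EqDist G w x y → EqDist G w y x
  eqDist-sym (k , dx , dy) = k , dy , dx

  common-neighbour⇒eqDist : ∀ {w x y} → Edge G w x → Edge G w y → EqDist G w x y
  common-neighbour⇒eqDist ex ey = 1 , dist-edge ex , dist-edge ey

  walk-length-bound : ∀ {F} → Lipschitz G F → ∀ {x y j} → Walk G x y j → F y ≤ F x + j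
  walk-length-bound {F} L {x} here = ≤-reflexive (sym (+-identityʳ (F x)))
  walk-length-bound {F} L {x} {z} (step {y = y} {k = k} e w) = begin
    F z           ≤⟨ walk-length-bound L w ⟩
    F y + k       ≤⟨ +-monoˡ-≤ k (L e) ⟩
    suc (F x + k) ≡⟨ +-suc (F x) k ⟨
    F x + suc k   ∎
    where open ≤-Reasoning

  dist-from-potential : ∀ {F} → Lipschitz G F → ∀ {x y k} → Walk G x y k → F y ≡ F x + k →
                        Dist G x y k
  dist-from-potential {F} L {x} {k = k} w rise = w , λ j w′ →
    +-cancelˡ-≤ (F x) k j (subst (_≤ F x + j) rise (walk-length-bound L w′))

  pendant⇒¬eqDist : ∀ {v p w} → v ≢ p → (∀ {y} → Edge G y p → y ≡ v) → ¬ EqDist G w v p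
  pendant⇒¬eqDist v≢p _ (zero , (wv , _) , (wp , _)) =
    v≢p (trans (sym (walk₀⇒≡ wv)) (walk₀⇒≡ wp))
  pendant⇒¬eqDist {w = w} _ only-v (suc k , (_ , shortest) , (wp , _))
    with y , wy , yp ← walk-unsnoc wp =
    n≮n k (shortest k (subst (λ y → Walk G w y k) (only-v yp) wy))

  ∉-independent⇒vertexCoverEB : ∀ {X} → IndepEB G (_∉ X) → VertexCoverEB G X
  ∉-independent⇒vertexCoverEB {X} indep x y xy with x ∈? X | y ∈? X
  ... | yes x∈X | _       = inj₁ x∈X
  ... | no _    | yes y∈X = inj₂ y∈X
  ... | no x∉X  | no y∉X  = contradiction xy (indep x y x∉X y∉X)

  distanceEqualizer-separates : ∀ {S x y} → DistanceEqualizer G S → x ≢ y →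
                                (∀ w → ¬ EqDist G w x y) → x ∈ S ⊎ y ∈ S
  distanceEqualizer-separates {S} {x} {y} equalizer x≢y never with x ∈? S | y ∈? S
  ... | yes x∈S | _       = inj₁ x∈S
  ... | no _    | yes y∈S = inj₂ y∈S
  ... | no x∉S  | no y∉S
    with w , _ , eq ← equalizer x y x≢y x∉S y∉S = contradiction eq (never w)

hits-all-pairs⇒n≤∣p∣ : ∀ n (p : Subset (n * 2)) →
                       (∀ i → combine {n} {2} i zero ∈ p ⊎ combine i (suc zero) ∈ p) → n ≤ ∣ p ∣
hits-all-pairs⇒n≤∣p∣ zero    _           _    = z≤n
hits-all-pairs⇒n≤∣p∣ (suc n) (a ∷ b ∷ p) hits =
  pair-step a b (hits zero)
    (hits-all-pairs⇒n≤∣p∣ n p (Sum.map drop-there² drop-there² ∘ hits ∘ suc))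
  where
  drop-there² : ∀ {x} → suc (suc x) ∈ a ∷ b ∷ p → x ∈ p
  drop-there² = drop-there ∘ drop-there

  pair-step : ∀ a b → zero ∈ a ∷ b ∷ p ⊎ suc zero ∈ a ∷ b ∷ p → n ≤ ∣ p ∣ → suc n ≤ ∣ a ∷ b ∷ p ∣
  pair-step true  b     _               n≤∣p∣ = s≤s (≤-trans n≤∣p∣ (∣p∣≤∣x∷p∣ b p))
  pair-step false true  _               n≤∣p∣ = s≤s n≤∣p∣
  pair-step false false (inj₁ ())
  pair-step false false (inj₂ (there ()))

one-per-pair⇒∣p∣≡n : ∀ n (p : Subset (n * 2)) →
                     (∀ i → lookup p (combine {n} {2} i zero) ≡ not (lookup p (combine i (suc zero)))) →
                     ∣ p ∣ ≡ n
one-per-pair⇒∣p∣≡n zero    []          _   = refl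
one-per-pair⇒∣p∣≡n (suc n) (a ∷ b ∷ p) one with refl ← one zero =
  trans (∣not-b∷b∷p∣ b) (cong suc (one-per-pair⇒∣p∣≡n n p (one ∘ suc)))
  where
  ∣not-b∷b∷p∣ : ∀ b → ∣ not b ∷ b ∷ p ∣ ≡ suc ∣ p ∣
  ∣not-b∷b∷p∣ true  = refl
  ∣not-b∷b∷p∣ false = refl

module Eccentricity≤2 {n} (G : Graph n) (u : Fin n) (ecc : EccLe G u 2) where

  non-neighbour⇒dist-2 : ∀ {x} → ¬ Edge G u x → x ≢ u → Dist G u x 2
  non-neighbour⇒dist-2 {x} ¬ux x≢u with ecc x
  ... | 0 , (here , _) , _                 = contradiction refl x≢u
  ... | 1 , (step ux here , _) , _         = contradiction ux ¬ux
  ... | 2 , d , _                          = d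
  ... | suc (suc (suc _)) , _ , s≤s (s≤s ())

  non-neighbour⇒common-neighbour : ∀ {x} → ¬ Edge G u x → x ≢ u →
                                   ∃ λ l → Edge G u l × Edge G l x
  non-neighbour⇒common-neighbour ¬ux x≢u with non-neighbour⇒dist-2 ¬ux x≢u
  ... | step ul (step lx here) , _ = _ , ul , lx

  neighbours-independent : IndepEB G (Edge G u)
  neighbours-independent x y ux uy (_ , none) = none (u , common-neighbour⇒eqDist ux uy)

  non-neighbours-independent : IndepEB G (λ x → ¬ Edge G u x)
  non-neighbours-independent x y ¬ux ¬uy (x≢y , none) with x ≟ u | y ≟ u
  ... | yes refl | yes refl = x≢y refl
  ... | yes refl | no y≢u
    with l , ul , ly ← non-neighbour⇒common-neighbour ¬uy y≢u =
    none (l , common-neighbour⇒eqDist (edge-sym G ul) ly)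
  ... | no x≢u | yes refl
    with l , ul , lx ← non-neighbour⇒common-neighbour ¬ux x≢u =
    none (l , common-neighbour⇒eqDist lx (edge-sym G ul))
  ... | no x≢u | no y≢u =
    none (u , 2 , non-neighbour⇒dist-2 ¬ux x≢u , non-neighbour⇒dist-2 ¬uy y≢u)

  L : Subset n
  L = tabulate (adj G u)

  ∈L⇒edge : ∀ {x} → x ∈ L → Edge G u x
  ∈L⇒edge = ∈-tabulate⁻ (adj G u)

  ∉L⇒¬edge : ∀ {x} → x ∉ L → ¬ Edge G u x
  ∉L⇒¬edge x∉L = x∉L ∘ ∈-tabulate⁺ (adj G u)

  forwardEqualized-∁L-L : ForwardEqualized G (∁ L) L
  forwardEqualized-∁L-L = covers , equalize
    where
    covers : ∀ x → x ∈ ∁ L ⊎ x ∈ L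
    covers x with x ∈? L
    ... | yes x∈L = inj₂ x∈L
    ... | no x∉L  = inj₁ (x∉p⇒x∈∁p x∉L)

    equalize : ∀ x y → x ∈ ∁ L → x ∉ L → y ∈ L → y ∉ ∁ L →
               ∃ λ w → ∃ λ k → Dist G w x (suc k) × Dist G w y k
    equalize x y _ x∉L y∈L _ with x ≟ u
    ... | yes refl = y , 0 , dist-edge (edge-sym G (∈L⇒edge y∈L)) , dist-refl
    ... | no x≢u   = u , 1 , non-neighbour⇒dist-2 (∉L⇒¬edge x∉L) x≢u , dist-edge (∈L⇒edge y∈L)

  betaStar≡0 : BetaStar G 0
  betaStar≡0 = (∁ L , L , feasible , trans (cong ∣_∣ (∩-inverseˡ L)) (∣⊥∣≡0 n)) , λ _ _ _ → z≤n
    where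
    feasible : BetaFeasible G (∁ L) L
    feasible =
      ∉-independent⇒vertexCoverEB (λ x y x∉∁L y∉∁L →
        neighbours-independent x y (∈L⇒edge (x∉∁p⇒x∈p x∉∁L)) (∈L⇒edge (x∉∁p⇒x∈p y∉∁L))) ,
      ∉-independent⇒vertexCoverEB (λ x y x∉L y∉L →
        non-neighbours-independent x y (∉L⇒¬edge x∉L) (∉L⇒¬edge y∉L)) ,
      forwardEqualized-∁L-L

  -- The distance from u, given that ε(u) ≤ 2.
  layer : Fin n → ℕ
  layer i with i ≟ u | adj G u i
  ... | yes _ | _     = 0
  ... | no _  | true  = 1
  ... | no _  | false = 2

  layer-centre : layer u ≡ 0
  layer-centre with u ≟ u
  ... | yes _   = refl
  ... | no u≢u  = contradiction refl u≢u

  layer-neighbour : ∀ {i} → Edge G u i → layer i ≡ 1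
  layer-neighbour {i} ui with i ≟ u
  ... | yes i≡u = contradiction (sym i≡u) (edge⇒≢ G ui)
  ... | no _ rewrite ui = refl

  layer-non-neighbour : ∀ {i} → ¬ Edge G u i → i ≢ u → layer i ≡ 2
  layer-non-neighbour {i} ¬ui i≢u with i ≟ u | adj G u i
  ... | yes i≡u | _     = contradiction i≡u i≢u
  ... | no _    | true  = contradiction refl ¬ui
  ... | no _    | false = refl

  layer≤2 : ∀ i → layer i ≤ 2
  layer≤2 i with i ≟ u | adj G u i
  ... | yes _ | _     = z≤n
  ... | no _  | true  = s≤s z≤n
  ... | no _  | false = ≤-refl

  layer-lipschitz : Lipschitz G layer
  layer-lipschitz {i} {j} ij with i ≟ u | adj G u i
  ... | yes refl | _     = ≤-reflexive (layer-neighbour ij)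
  ... | no _     | true  = layer≤2 j
  ... | no _     | false = ≤-trans (layer≤2 j) (n≤1+n 2)

module Corona {n k} (G : Graph n) (H : Graph k) where

  Γ : Graph (n * suc k)
  Γ = corona G H

  base : Fin n → Fin (n * suc k)
  base i = combine i zero

  fibre : Fin n → Fin k → Fin (n * suc k)
  fibre i a = combine i (suc a)

  data Located : Fin (n * suc k) → Set where
    at-base  : ∀ i → Located (base i)
    in-fibre : ∀ i a → Located (fibre i a)

  locate : ∀ x → Located x
  locate x = subst Located (combine-remQuot {n} (suc k) x) (locate-pair (remQuot (suc k) x))
    where
    locate-pair : ∀ p → Located (uncurry combine p)
    locate-pair (i , zero)  = at-base i
    locate-pair (i , suc a) = in-fibre i a

  edge⁺ : ∀ {i a j b} → coronaAdj G H (i , a) (j , b) ≡ true → Edge Γ (combine i a) (combine j b)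
  edge⁺ {i} {a} {j} {b} = subst₂ (λ p q → coronaAdj G H p q ≡ true)
                                 (sym (remQuot-combine i a)) (sym (remQuot-combine j b))

  edge⁻ : ∀ {i a j b} → Edge Γ (combine i a) (combine j b) → coronaAdj G H (i , a) (j , b) ≡ true
  edge⁻ {i} {a} {j} {b} = subst₂ (λ p q → coronaAdj G H p q ≡ true)
                                 (remQuot-combine i a) (remQuot-combine j b)

  base-edge : ∀ {i j} → Edge G i j → Edge Γ (base i) (base j)
  base-edge = edge⁺

  base-walk : ∀ {i j l} → Walk G i j l → Walk Γ (base i) (base j) l
  base-walk here       = here
  base-walk (step e w) = step (base-edge e) (base-walk w)

  base-fibre-edge : ∀ i a → Edge Γ (base i) (fibre i a)
  base-fibre-edge i a = edge⁺ (≡⇒≟ refl)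

  coronaS-base : ∀ u i → coronaS {n} {k} G u (base i) ≡ adj G u i
  coronaS-base u i rewrite remQuot-combine {n} {suc k} i zero = refl

  coronaS-fibre : ∀ u i a → coronaS {n} {k} G u (fibre i a) ≡ not (adj G u i)
  coronaS-fibre u i a rewrite remQuot-combine {n} {suc k} i (suc a) = refl

  fibreLevel : ℕ → ℕ
  fibreLevel zero    = zero
  fibreLevel (suc d) = 3 + d

  fibreLevel-≤-2+ : ∀ d → fibreLevel d ≤ 2 + d
  fibreLevel-≤-2+ zero    = z≤n
  fibreLevel-≤-2+ (suc d) = ≤-refl

  ≤-fibreLevel : ∀ d → d ≤ fibreLevel d
  ≤-fibreLevel zero    = z≤n
  ≤-fibreLevel (suc d) = m≤n+m (suc d) 2

  -- For g = d_G(u, ·) this is a lower bound for the distance from a vertex of H_u: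
  -- v_i lies at distance 1 + d(u, i), and H_i (i ≠ u) at distance 2 + d(u, i).
  pairPotential : (Fin n → ℕ) → Fin n × Fin (suc k) → ℕ
  pairPotential g (i , zero)  = suc (g i)
  pairPotential g (i , suc _) = fibreLevel (g i)

  potential : (Fin n → ℕ) → Fin (n * suc k) → ℕ
  potential g = pairPotential g ∘ remQuot (suc k)

  potential-base : ∀ g i → potential g (base i) ≡ suc (g i)
  potential-base g i = cong (pairPotential g) (remQuot-combine i zero)

  potential-fibre : ∀ g i a → potential g (fibre i a) ≡ fibreLevel (g i)
  potential-fibre g i a = cong (pairPotential g) (remQuot-combine i (suc a))

  potential-lipschitz : ∀ {g} → Lipschitz G g → Lipschitz Γ (potential g)
  potential-lipschitz {g} L {x} {y} = pair-lipschitz (remQuot (suc k) x) (remQuot (suc k) y)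
    where
    pair-lipschitz : ∀ p q → coronaAdj G H p q ≡ true → pairPotential g q ≤ suc (pairPotential g p)
    pair-lipschitz (i , zero)  (j , zero)  e = s≤s (L e)
    pair-lipschitz (i , zero)  (j , suc _) e with refl ← ≟⇒≡ e = fibreLevel-≤-2+ (g i)
    pair-lipschitz (i , suc _) (j , zero)  e with refl ← ≟⇒≡ e = s≤s (≤-fibreLevel (g i))
    pair-lipschitz (i , suc _) (j , suc _) e with refl ← ≟⇒≡ (∧-conicalˡ ⌊ i ≟ j ⌋ _ e) = n≤1+n _

module CoronaEqualizer {n m} (G : Graph n) (H : Graph (suc m)) (u : Fin n) (ecc : EccLe G u 2) where
  open Eccentricity≤2 G u ecc
  open Corona G H

  S : Subset (n * suc (suc m))
  S = coronaSet {n} {suc m} G u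

  base-∈S : ∀ {i} → Edge G u i → base i ∈ S
  base-∈S {i} ui = ∈-tabulate⁺ (coronaS G u) (trans (coronaS-base u i) ui)

  base-∉S : ∀ {i} → base i ∉ S → ¬ Edge G u i
  base-∉S i∉S = i∉S ∘ base-∈S

  fibre-∉S : ∀ {i a} → fibre i a ∉ S → Edge G u i
  fibre-∉S {i} {a} ia∉S with adj G u i in ui
  ... | true  = refl
  ... | false =
    contradiction (∈-tabulate⁺ (coronaS G u) (trans (coronaS-fibre u i a) (cong not ui))) ia∉S

  h₀ : Fin (n * suc (suc m))
  h₀ = fibre u zero

  h₀-base-u : Edge Γ h₀ (base u)
  h₀-base-u = edge-sym Γ (base-fibre-edge u zero)

  h₀-∈S : h₀ ∈ S
  h₀-∈S = ∈-tabulate⁺ (coronaS G u) (trans (coronaS-fibre u u zero) (cong not (adj-irrefl G u)))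

  dist-h₀-3 : ∀ {x} → Walk Γ h₀ x 3 → potential layer x ≡ 3 → Dist Γ h₀ x 3
  dist-h₀-3 {x} w x-at-3 = dist-from-potential (potential-lipschitz layer-lipschitz) w (begin
    potential layer x        ≡⟨ x-at-3 ⟩
    3                        ≡⟨ cong (λ d → fibreLevel d + 3) layer-centre ⟨
    fibreLevel (layer u) + 3 ≡⟨ cong (_+ 3) (potential-fibre layer u zero) ⟨
    potential layer h₀ + 3   ∎)
    where open ≡-Reasoning

  far-from-h₀ : ∀ {x} → x ∉ S → x ≢ base u → Dist Γ h₀ x 3
  far-from-h₀ {x} x∉S x≢u with locate x
  ... | at-base i =
    dist-h₀-3 (step h₀-base-u (base-walk (proj₁ (non-neighbour⇒dist-2 ¬ui i≢u))))
              (trans (potential-base layer i) (cong suc (layer-non-neighbour ¬ui i≢u)))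
    where
    ¬ui : ¬ Edge G u i
    ¬ui = base-∉S x∉S
    i≢u : i ≢ u
    i≢u = x≢u ∘ cong base
  ... | in-fibre j b =
    dist-h₀-3 (step h₀-base-u (step (base-edge uj) (step (base-fibre-edge j b) here)))
              (trans (potential-fibre layer j b) (cong fibreLevel (layer-neighbour uj)))
    where
    uj : Edge G u j
    uj = fibre-∉S x∉S

  equalized-with-base-u : ∀ {x} → x ∉ S → x ≢ base u → ∃ λ w → w ∈ S × EqDist Γ w x (base u)
  equalized-with-base-u {x} x∉S x≢u with locate x
  ... | at-base i
    with l , ul , li ← non-neighbour⇒common-neighbour (base-∉S x∉S) (x≢u ∘ cong base) =
    base l , base-∈S ul , common-neighbour⇒eqDist (base-edge li) (base-edge (edge-sym G ul))
  ... | in-fibre j b =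
    base j , base-∈S uj , common-neighbour⇒eqDist (base-fibre-edge j b) (base-edge (edge-sym G uj))
    where
    uj : Edge G u j
    uj = fibre-∉S x∉S

  coronaSet-distanceEqualizer : DistanceEqualizer Γ S
  coronaSet-distanceEqualizer x y x≢y x∉S y∉S with x ≟ base u | y ≟ base u
  ... | yes refl | yes refl = contradiction refl x≢y
  ... | yes refl | no y≢u
    with w , w∈S , eq ← equalized-with-base-u y∉S y≢u = w , w∈S , eqDist-sym eq
  ... | no x≢u   | yes refl = equalized-with-base-u x∉S x≢u
  ... | no x≢u   | no y≢u   = h₀ , h₀-∈S , 3 , far-from-h₀ x∉S x≢u , far-from-h₀ y∉S y≢u

module PendantCorona {n} (G : Graph n) where
  open Corona G K₁

  base≢fibre : ∀ i → base i ≢ fibre i zero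
  base≢fibre i e with () ← combine-injectiveʳ i zero i (suc zero) e

  fibre-neighbour≡base : ∀ {x i} → Edge Γ x (fibre i zero) → x ≡ base i
  fibre-neighbour≡base {x} e with locate x
  ... | at-base j        = cong base (≟⇒≡ (edge⁻ e))
  ... | in-fibre j zero with () ← ∧-conicalʳ ⌊ j ≟ _ ⌋ false (edge⁻ e)

  distanceEqualizer-meets-pairs : ∀ {T} → DistanceEqualizer Γ T →
                                  ∀ i → base i ∈ T ⊎ fibre i zero ∈ T
  distanceEqualizer-meets-pairs equalizer i =
    distanceEqualizer-separates equalizer (base≢fibre i)
      (λ _ → pendant⇒¬eqDist (base≢fibre i) fibre-neighbour≡base)

  ∣coronaSet∣≡n : ∀ u → ∣ coronaSet {n} {1} G u ∣ ≡ n
  ∣coronaSet∣≡n u = one-per-pair⇒∣p∣≡n n (coronaSet G u) λ i → begin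
    lookup (coronaSet G u) (base i)             ≡⟨ lookup∘tabulate (coronaS G u) (base i) ⟩
    coronaS G u (base i)                        ≡⟨ coronaS-base u i ⟩
    adj G u i                                   ≡⟨ not-involutive (adj G u i) ⟨
    not (not (adj G u i))                       ≡⟨ cong not (coronaS-fibre u i zero) ⟨
    not (coronaS G u (fibre i zero))            ≡⟨ cong not (lookup∘tabulate (coronaS G u) (fibre i zero)) ⟨
    not (lookup (coronaSet G u) (fibre i zero)) ∎
    where open ≡-Reasoning

proposition34 : ∀ {n m} (G : Graph n) (H : Graph (suc m)) (u : Fin n) →
    EccLe G u 2 →
    (IndepEB G (λ x → Edge G u x) × IndepEB G (λ x → ¬ Edge G u x))
    × DistanceEqualizer (corona G H) (coronaSet {n} {suc m} G u)
    × BetaStar G 0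
    × Xi (corona G K₁) n
proposition34 {n} G H u ecc =
  (neighbours-independent , non-neighbours-independent) ,
  CoronaEqualizer.coronaSet-distanceEqualizer G H u ecc ,
  betaStar≡0 ,
  ((coronaSet G u , CoronaEqualizer.coronaSet-distanceEqualizer G K₁ u ecc , ∣coronaSet∣≡n u) ,
   λ T equalizer → hits-all-pairs⇒n≤∣p∣ n T (distanceEqualizer-meets-pairs equalizer))
  where
  open Eccentricity≤2 G u ecc
  open PendantCorona G
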